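{- Let $n,q$ be integers with $q\ge2$, let $V=K_n$, and let $\ell\ge1$ be a power of two with $\ell\le n/2$. Then the recovery number satisfies $R_{V,\ell}\ge\ell/2$.
   Context: $K_n\in\{0,1\}^n$ is defined by $K_n[i]=1$ if $n-1-i$ is a power of two (i.e. equals $2^k$ for some integer $k\ge0$), and $K_n[i]=0$ otherwise, for $i\in\{0,\dots,n-1\}$. $M_{V,\ell}$ is the $\ell\times\ell$ matrix over $\mathbb{Z}/q\mathbb{Z}$ with entries $M_{V,\ell}(i,j)=V[n-1-(\ell+i)+j]$ for $i,j\in\{0,\dots,\ell-1\}$. The recovery number $R_{V,\ell}$ is the number of indices $k\in\{1,\dots,\ell\}$ such that any $x,x'\in(\mathbb{Z}/q\mathbb{Z})^\ell$ with $M_{V,\ell}x=M_{V,\ell}x'$ satisfy $x_k=x'_k$. -}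

module Defs where

open import Data.Bool using (Bool; if_then_else_)
open import Data.Nat using (ℕ; zero; suc; _∸_; _+_; _^_; _≡ᵇ_)
open import Data.Fin using (Fin; toℕ)
open import Data.List using (upTo)
open import Data.Bool.ListAction using (any)
open import Data.Integer using (ℤ; +_; _-_; _*_)
import Data.Integer as ℤ
open import Data.Integer.Divisibility using (_∣_)
open import Data.Product using (∃)
open import Relation.Binary.PropositionalEquality using (_≡_)
import Data.Vec.Functional as VF

IsPow2 : ℕ → Set
IsPow2 m = ∃ λ k → 2 ^ k ≡ m

-- Boolean decision of IsPow2 by bounded search (2^k > m whenever k > m)
isPow2ᵇ : ℕ → Bool
isPow2ᵇ m = any (λ k → 2 ^ k ≡ᵇ m) (upTo (suc m))

-- The word K_n, indexed by naturals i (only i < n is meaningful):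
-- K_n[i] = 1 if n-1-i is a power of two, else 0.
K : ℕ → ℕ → ℤ
K n i = if isPow2ᵇ (n ∸ 1 ∸ i) then + 1 else + 0

-- Elements of Z/qZ are represented by integers; equality in Z/qZ is congruence mod q.
_≡[mod_]_ : ℤ → ℕ → ℤ → Set
a ≡[mod q ] b = + q ∣ (a - b)

-- The matrix M_{V,ℓ}(i,j) = V[n-1-(ℓ+i)+j]   (n is the length of V)
M : (n : ℕ) → (ℕ → ℤ) → (ℓ : ℕ) → Fin ℓ → Fin ℓ → ℤ
M n V ℓ i j = V ((n ∸ 1 ∸ (ℓ + toℕ i)) + toℕ j)

Σℤ : ∀ {ℓ} → (Fin ℓ → ℤ) → ℤ
Σℤ = VF.foldr ℤ._+_ (+ 0)

_·_ : ∀ {ℓ} → (Fin ℓ → Fin ℓ → ℤ) → (Fin ℓ → ℤ) → Fin ℓ → ℤ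
(A · x) i = Σℤ (λ j → A i j * x j)

-- Index k (0-based; paper's k+1) is recoverable for M_{V,ℓ} over Z/qZ:
-- any x, x' with M x = M x' (mod q) satisfy x_k = x'_k (mod q).
Recoverable : (q n : ℕ) → (ℕ → ℤ) → (ℓ : ℕ) → Fin ℓ → Set
Recoverable q n V ℓ k =
  (x x' : Fin ℓ → ℤ) →
  (∀ i → (M n V ℓ · x) i ≡[mod q ] (M n V ℓ · x') i) →
  x k ≡[mod q ] x' k

-- Row k of M_{K_n,ℓ} has a 1 in column j iff ℓ + k − j is a power of two. For the
-- lower half of the rows, ℓ/2 ≤ k < ℓ, every such value lies in the interval
-- (ℓ/2, 2ℓ), whose only power of two is ℓ itself (attained at j = k). So these ℓ/2
-- rows are unit vectors, and (M x)_k = x_k recovers the k-th coordinate.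
module Submission where

open import Defs
open import Data.Nat using (ℕ; zero; suc; _+_; _∸_; _*_; _^_; _≤_; _<_; z≤n; s≤s; z<s; _≡ᵇ_)
open import Data.Nat.Properties
open import Data.Bool using (true; false; T)
open import Data.List using (upTo)
open import Data.List.Relation.Unary.Any using (satisfied)
open import Data.List.Relation.Unary.Any.Properties using (any⁺; any⁻)
open import Data.List.Membership.Propositional using (lose)
open import Data.List.Membership.Propositional.Properties using (∈-upTo⁺)
open import Data.Fin using (Fin; toℕ; punchIn)
open import Data.Fin.Properties using (toℕ-injective; toℕ<n; punchInᵢ≢i)
open import Data.Fin.Subset using (Subset; _∈_; ∣_∣; outside; ⊤)
open import Data.Fin.Subset.Properties using (∣⊤∣≡n)
open import Data.Vec using (replicate; _++_; there)
open import Data.Integer using (ℤ; +_)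
import Data.Integer as ℤ
import Data.Integer.Properties as ℤ
open import Data.Integer.Divisibility using (_∣_)
open import Algebra.Properties.CommutativeMonoid.Sum ℤ.+-0-commutativeMonoid
  using (sum-remove; sum-cong-≗; sum-replicate-zero)
open import Data.Product using (Σ; ∃; _×_; _,_)
open import Function using (_∘_)
open import Relation.Nullary using (¬_; contradiction)
open import Relation.Binary.PropositionalEquality
  using (_≡_; _≢_; refl; sym; trans; cong; cong₂; subst; module ≡-Reasoning)

n<2^n : ∀ n → n < 2 ^ n
n<2^n zero    = z<s
n<2^n (suc n) = ≤-<-trans (n<2^n n)
  (subst (2 ^ n <_) (*-comm (2 ^ n) 2) (m<m*n (2 ^ n) 2 {{m^n≢0 2 n}} (s≤s (s≤s z≤n))))

2^-cancel-< : ∀ m n → 2 ^ m < 2 ^ n → m < n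
2^-cancel-< m n 2^m<2^n = ≰⇒> (λ n≤m → <⇒≱ 2^m<2^n (^-monoʳ-≤ 2 n≤m))

isPow2-between⇒≡ : ∀ {v} a → IsPow2 v → 2 ^ a < 2 * v → v < 2 * 2 ^ a → v ≡ 2 ^ a
isPow2-between⇒≡ a (c , refl) lower upper =
  cong (2 ^_) (≤-antisym (≤-pred (2^-cancel-< c (suc a) upper))
                         (≤-pred (2^-cancel-< a (suc c) lower)))

isPow2ᵇ-sound : ∀ m → T (isPow2ᵇ m) → IsPow2 m
isPow2ᵇ-sound m t with c , eq ← satisfied (any⁻ (λ c → 2 ^ c ≡ᵇ m) (upTo (suc m)) t) =
  c , ≡ᵇ⇒≡ (2 ^ c) m eq

isPow2ᵇ-complete : ∀ {m} → IsPow2 m → T (isPow2ᵇ m)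
isPow2ᵇ-complete (c , refl) =
  any⁺ _ (lose (∈-upTo⁺ (s≤s (<⇒≤ (n<2^n c)))) (≡⇒≡ᵇ (2 ^ c) (2 ^ c) refl))

K-isPow2 : ∀ n i → IsPow2 (n ∸ 1 ∸ i) → K n i ≡ + 1
K-isPow2 n i p with isPow2ᵇ (n ∸ 1 ∸ i) | isPow2ᵇ-complete p
... | true | _ = refl

K-notPow2 : ∀ n i → ¬ IsPow2 (n ∸ 1 ∸ i) → K n i ≡ + 0
K-notPow2 n i ¬p with isPow2ᵇ (n ∸ 1 ∸ i) in eq
... | false = refl
... | true  = contradiction (isPow2ᵇ-sound _ (subst T (sym eq) _)) ¬p

Σℤ-single : ∀ {ℓ} (f : Fin ℓ → ℤ) k → (∀ j → j ≢ k → f j ≡ + 0) → Σℤ f ≡ f k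
Σℤ-single {suc ℓ} f k vanish = begin
  Σℤ f                                      ≡⟨ sum-remove f ⟩
  f k ℤ.+ Σℤ (λ j → f (punchIn k j))        ≡⟨ cong (λ s → f k ℤ.+ s) sumRest≡0 ⟩
  f k ℤ.+ + 0                               ≡⟨ ℤ.+-identityʳ (f k) ⟩
  f k                                       ∎
  where
  open ≡-Reasoning
  sumRest≡0 : Σℤ (λ j → f (punchIn k j)) ≡ + 0
  sumRest≡0 = trans (sum-cong-≗ (λ j → vanish _ (punchInᵢ≢i k j))) (sum-replicate-zero ℓ)

·-unitRow : ∀ {ℓ} (A : Fin ℓ → Fin ℓ → ℤ) k → A k k ≡ + 1 → (∀ j → j ≢ k → A k j ≡ + 0) →
            ∀ x → (A · x) k ≡ x k
·-unitRow A k diagonal offDiagonal x = begin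
  Σℤ (λ j → A k j ℤ.* x j) ≡⟨ Σℤ-single _ k offDiagonalTerm ⟩
  A k k ℤ.* x k            ≡⟨ cong (ℤ._* x k) diagonal ⟩
  + 1 ℤ.* x k              ≡⟨ ℤ.*-identityˡ (x k) ⟩
  x k                      ∎
  where
  open ≡-Reasoning
  offDiagonalTerm : ∀ j → j ≢ k → A k j ℤ.* x j ≡ + 0
  offDiagonalTerm j j≢k = trans (cong (ℤ._* x j) (offDiagonal j j≢k)) (ℤ.*-zeroˡ (x j))

Recoverable-unitRow : ∀ q n V ℓ k → (∀ x → (M n V ℓ · x) k ≡ x k) → Recoverable q n V ℓ k
Recoverable-unitRow q n V ℓ k rowₖ x x′ Mx≡Mx′ =
  subst (λ d → + q ∣ d) (cong₂ ℤ._-_ (rowₖ x) (rowₖ x′)) (Mx≡Mx′ k)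

m∸[m∸n+o]≡n∸o : ∀ {m n} o → n ≤ m → m ∸ (m ∸ n + o) ≡ n ∸ o
m∸[m∸n+o]≡n∸o {m} {n} o n≤m =
  trans (sym (∸-+-assoc m (m ∸ n) o)) (cong (_∸ o) (m∸[m∸n]≡n n≤m))

M-distance : ∀ {n ℓ} (k j : Fin ℓ) → 2 * ℓ ≤ n →
             n ∸ 1 ∸ (n ∸ 1 ∸ (ℓ + toℕ k) + toℕ j) ≡ ℓ + toℕ k ∸ toℕ j
M-distance {n} {ℓ} k j 2ℓ≤n = m∸[m∸n+o]≡n∸o (toℕ j) (∸-monoˡ-≤ 1 ℓ+k<n)
  where
  ℓ+k<n : ℓ + toℕ k < n
  ℓ+k<n = ≤-trans (+-monoʳ-< ℓ (≤-trans (toℕ<n k) (≤-reflexive (sym (+-identityʳ ℓ))))) 2ℓ≤n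

distance-notPow2 : ∀ a {k j} → j < 2 ^ a → k < 2 ^ a → 2 ^ a < 2 * suc k → j ≢ k →
                   ¬ IsPow2 (2 ^ a + k ∸ j)
distance-notPow2 a {k} {j} j<ℓ k<ℓ ℓ<2[1+k] j≢k isPow2 = j≢k (+-cancelˡ-≡ ℓ j k ℓ+j≡ℓ+k)
  where
  open ≡-Reasoning
  ℓ = 2 ^ a
  v = ℓ + k ∸ j
  j≤ℓ+k : j ≤ ℓ + k
  j≤ℓ+k = ≤-trans (<⇒≤ j<ℓ) (m≤m+n ℓ k)
  k<v : k < v
  k<v = m+n≤o⇒m≤o∸n (suc k) (≤-trans (+-monoʳ-< k j<ℓ) (≤-reflexive (+-comm k ℓ)))
  v<2ℓ : v < 2 * ℓ
  v<2ℓ = ≤-<-trans (m∸n≤m (ℓ + k) j)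
           (+-monoʳ-< ℓ (≤-trans k<ℓ (≤-reflexive (sym (+-identityʳ ℓ)))))
  v≡ℓ : v ≡ ℓ
  v≡ℓ = isPow2-between⇒≡ a isPow2 (<-≤-trans ℓ<2[1+k] (*-monoʳ-≤ 2 k<v)) v<2ℓ
  ℓ+j≡ℓ+k : ℓ + j ≡ ℓ + k
  ℓ+j≡ℓ+k = begin
    ℓ + j ≡⟨ cong (_+ j) (sym v≡ℓ) ⟩
    v + j ≡⟨ m∸n+n≡m j≤ℓ+k ⟩
    ℓ + k ∎

M-K-diagonal : ∀ n a (k : Fin (2 ^ a)) → 2 * 2 ^ a ≤ n → M n (K n) (2 ^ a) k k ≡ + 1
M-K-diagonal n a k 2ℓ≤n = K-isPow2 n (n ∸ 1 ∸ (2 ^ a + toℕ k) + toℕ k)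
  (subst IsPow2 (sym (trans (M-distance k k 2ℓ≤n) (m+n∸n≡m (2 ^ a) (toℕ k)))) (a , refl))

M-K-offDiagonal : ∀ n a {k j : Fin (2 ^ a)} → 2 * 2 ^ a ≤ n → 2 ^ a < 2 * suc (toℕ k) → j ≢ k →
                  M n (K n) (2 ^ a) k j ≡ + 0
M-K-offDiagonal n a {k} {j} 2ℓ≤n ℓ<2[1+k] j≢k =
  K-notPow2 n (n ∸ 1 ∸ (2 ^ a + toℕ k) + toℕ j)
    (subst (λ d → ¬ IsPow2 d) (sym (M-distance k j 2ℓ≤n))
      (distance-notPow2 a (toℕ<n j) (toℕ<n k) ℓ<2[1+k] (j≢k ∘ toℕ-injective)))

K-recoverable : ∀ q n {ℓ} → (∃ λ a → ℓ ≡ 2 ^ a) → 2 * ℓ ≤ n →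
                ∀ k → ℓ < 2 * suc (toℕ k) → Recoverable q n (K n) ℓ k
K-recoverable q n (a , refl) 2ℓ≤n k ℓ<2[1+k] = Recoverable-unitRow q n (K n) (2 ^ a) k
  (·-unitRow (M n (K n) (2 ^ a)) k (M-K-diagonal n a k 2ℓ≤n)
    (λ j → M-K-offDiagonal n a 2ℓ≤n ℓ<2[1+k]))

indices≥ : ∀ h {m} → Subset (h + m)
indices≥ h = replicate h outside ++ ⊤

∈-indices≥⇒≤ : ∀ h {m} {k : Fin (h + m)} → k ∈ indices≥ h → h ≤ toℕ k
∈-indices≥⇒≤ zero    _          = z≤n
∈-indices≥⇒≤ (suc h) (there k∈) = s≤s (∈-indices≥⇒≤ h k∈)

∣indices≥∣ : ∀ h {m} → ∣ indices≥ h {m} ∣ ≡ m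
∣indices≥∣ zero    {m} = ∣⊤∣≡n m
∣indices≥∣ (suc h)     = ∣indices≥∣ h

K-recoverable-indices≥ : ∀ q n h m → (∃ λ a → h + m ≡ 2 ^ a) → h ≤ m → m ≤ suc h →
  2 * (h + m) ≤ n →
  Σ (Subset (h + m)) λ S → (∀ k → k ∈ S → Recoverable q n (K n) (h + m) k) × h + m ≤ 2 * ∣ S ∣
K-recoverable-indices≥ q n h m pow h≤m m≤1+h 2ℓ≤n =
  indices≥ h , (λ k k∈S → K-recoverable q n pow 2ℓ≤n k (ℓ<2[1+k] k k∈S)) , ℓ≤2∣S∣
  where
  ℓ<2[1+k] : ∀ k → k ∈ indices≥ h → h + m < 2 * suc (toℕ k)
  ℓ<2[1+k] k k∈S = ≤-trans
    (s≤s (+-monoʳ-≤ h (≤-trans m≤1+h (≤-reflexive (sym (+-identityʳ (suc h)))))))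
    (*-monoʳ-≤ 2 (s≤s (∈-indices≥⇒≤ h k∈S)))
  ℓ≤2∣S∣ : h + m ≤ 2 * ∣ indices≥ h ∣
  ℓ≤2∣S∣ = subst (λ s → h + m ≤ 2 * s) (sym (∣indices≥∣ h))
    (+-mono-≤ h≤m (≤-reflexive (sym (+-identityʳ m))))

lemma5 : (n q ℓ : ℕ) → 2 ≤ q → 1 ≤ ℓ → (∃ λ k → ℓ ≡ 2 ^ k) → 2 * ℓ ≤ n →
    Σ (Subset ℓ) λ S →
      (∀ k → k ∈ S → Recoverable q n (K n) ℓ k) × ℓ ≤ 2 * ∣ S ∣
-- For ℓ = 2 ^ suc b the index type
-- Fin ℓ is definitionally Fin (2 ^ b + (2 ^ b + 0)), split into its two halves.
lemma5 n q .1 _ _ pow@(zero , refl) 2ℓ≤n =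
  K-recoverable-indices≥ q n 0 1 pow z≤n (s≤s z≤n) 2ℓ≤n
lemma5 n q _ _ _ pow@(suc b , refl) 2ℓ≤n =
  K-recoverable-indices≥ q n (2 ^ b) (2 ^ b + 0) pow (m≤m+n (2 ^ b) 0)
    (≤-trans (≤-reflexive (+-identityʳ (2 ^ b))) (n≤1+n (2 ^ b))) 2ℓ≤n
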